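{- Let $A$ be an MV-monoidal algebra, let $m\in\mathbb{N}$, and let $(a_0,\dots,a_m,0,0,\dots)$ and $(b_0,\dots,b_m,0,0,\dots)$ be good sequences in $A$. Then $(a_0\odot b_m)\oplus(a_1\odot b_{m-1})\oplus\dots\oplus(a_m\odot b_0)=a_0\odot(a_1\oplus b_m)\odot(a_2\oplus b_{m-1})\odot\dots\odot(a_m\oplus b_1)\odot b_0$ and $(a_0\oplus b_m)\odot(a_1\oplus b_{m-1})\odot\dots\odot(a_m\oplus b_0)=b_m\oplus(a_0\odot b_{m-1})\oplus(a_1\odot b_{m-2})\oplus\dots\oplus(a_{m-1}\odot b_0)\oplus a_m$.
   Context: An MV-monoidal algebra is an algebra $\langle A;\oplus,\odot,\vee,\wedge,0,1\rangle$ satisfying: $\langle A;\vee,\wedge\rangle$ is a distributive lattice; $\langle A;\oplus,0\rangle$ and $\langle A;\odot,1\rangle$ are commutative monoids; $\oplus$ and $\odot$ both distribute over both $\vee$ and $\wedge$; $(x\oplus y)\odot((x\odot y)\oplus z)=(x\odot(y\oplus z))\oplus(y\odot z)$; $(x\odot y)\oplus((x\oplus y)\odot z)=(x\oplus(y\odot z))\odot(y\oplus z)$; $(x\odot y)\oplus z=((x\oplus y)\odot((x\odot y)\oplus z))\vee z$; $(x\oplus y)\odot z=((x\odot y)\oplus((x\oplus y)\odot z))\wedge z$. A good pair is $(x_0,x_1)$ with $x_0\oplus x_1=x_0$ and $x_0\odot x_1=x_1$; a good sequence is a sequence in $A$, eventually $0$, in which every two consecutive terms form a good pair. -}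

module Defs where

open import Level using (Level; suc; _⊔_)
open import Data.Nat using (ℕ; zero; _<_)
import Data.Nat as ℕ
open import Relation.Binary.PropositionalEquality using (_≡_)
open import Algebra.Lattice.Structures using (IsDistributiveLattice)
open import Algebra.Structures using (IsCommutativeMonoid)

record MVMonoidal (ℓ : Level) : Set (suc ℓ) where
  infixl 7 _⊙_
  infixl 6 _⊕_
  infixl 5 _∨_
  infixl 5 _∧_
  field
    Carrier : Set ℓ
    _⊕_ _⊙_ _∨_ _∧_ : Carrier → Carrier → Carrier
    𝟘 𝟙 : Carrier
    isDistributiveLattice : IsDistributiveLattice _≡_ _∨_ _∧_
    ⊕-isCommutativeMonoid : IsCommutativeMonoid _≡_ _⊕_ 𝟘
    ⊙-isCommutativeMonoid : IsCommutativeMonoid _≡_ _⊙_ 𝟙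
    -- ⊕ and ⊙ distribute over ∨ and ∧ (commutativity gives the other side)
    ⊕-distrib-∨ : ∀ x y z → x ⊕ (y ∨ z) ≡ (x ⊕ y) ∨ (x ⊕ z)
    ⊕-distrib-∧ : ∀ x y z → x ⊕ (y ∧ z) ≡ (x ⊕ y) ∧ (x ⊕ z)
    ⊙-distrib-∨ : ∀ x y z → x ⊙ (y ∨ z) ≡ (x ⊙ y) ∨ (x ⊙ z)
    ⊙-distrib-∧ : ∀ x y z → x ⊙ (y ∧ z) ≡ (x ⊙ y) ∧ (x ⊙ z)
    ax1 : ∀ x y z → (x ⊕ y) ⊙ ((x ⊙ y) ⊕ z) ≡ (x ⊙ (y ⊕ z)) ⊕ (y ⊙ z)
    ax2 : ∀ x y z → (x ⊙ y) ⊕ ((x ⊕ y) ⊙ z) ≡ (x ⊕ (y ⊙ z)) ⊙ (y ⊕ z)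
    ax3 : ∀ x y z → (x ⊙ y) ⊕ z ≡ ((x ⊕ y) ⊙ ((x ⊙ y) ⊕ z)) ∨ z
    ax4 : ∀ x y z → (x ⊕ y) ⊙ z ≡ ((x ⊙ y) ⊕ ((x ⊕ y) ⊙ z)) ∧ z

module _ {ℓ : Level} (A : MVMonoidal ℓ) where
  open MVMonoidal A

  GoodPair : Carrier → Carrier → Set ℓ
  GoodPair x₀ x₁ = (x₀ ⊕ x₁ ≡ x₀) × (x₀ ⊙ x₁ ≡ x₁)
    where open import Data.Product using (_×_)

  record GoodSeqUpTo (m : ℕ) (a : ℕ → Carrier) : Set ℓ where
    field
      vanish : ∀ i → m < i → a i ≡ 𝟘
      good   : ∀ i → GoodPair (a i) (a (ℕ.suc i))

  sumBelow : ℕ → (ℕ → Carrier) → Carrier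
  sumBelow zero f = 𝟘
  sumBelow (ℕ.suc n) f = sumBelow n f ⊕ f n

  prodBelow : ℕ → (ℕ → Carrier) → Carrier
  prodBelow zero f = 𝟙
  prodBelow (ℕ.suc n) f = prodBelow n f ⊙ f n

-- In an MV-monoidal algebra the good pairs (x , y) with a fixed first component x are closed
-- under ⊕, under ⊙ by anything, and compose transitively, and for such a pair the identity
-- x ⊙ (y ⊕ z) ≡ y ⊕ x ⊙ z lets x pass through a sum. Both formulas are then proved by induction
-- on the number of factors, reading b backwards as y i = b (m ∸ i), so that consecutive terms
-- of y form good pairs in the reverse order. The invariant of the first induction is that the
-- partial product a₀ ⊙ (a₁ ⊕ y₀) ⊙ … ⊙ (aₖ ⊕ yₖ₋₁) forms a good pair with aₖ₊₁; that of the
-- second is that yₖ₊₁ forms a good pair with the partial sum y₀ ⊕ a₀ ⊙ y₁ ⊕ … ⊕ aₖ₋₁ ⊙ yₖ.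
module Submission where

open import Defs
open import Level using (Level)
open import Data.Nat using (ℕ; suc; _∸_)
open import Data.Product using (_×_)
open import Relation.Binary.PropositionalEquality using (_≡_)

open import Data.Nat using (zero; _≤_; _<_)
open import Data.Nat.Properties using (<⇒≤; ≤-refl; n∸n≡0; +-∸-assoc)
open import Data.Product using (_,_)
open import Function using (_∘_)
open import Relation.Binary.PropositionalEquality
  using (sym; trans; cong; cong₂; subst; subst₂; module ≡-Reasoning)
open import Algebra.Bundles using (CommutativeMonoid)
open import Algebra.Structures using (IsCommutativeMonoid)
open import Algebra.Lattice.Bundles using (Lattice)
open import Algebra.Lattice.Structures using (IsDistributiveLattice; IsLattice)
import Algebra.Lattice.Properties.Lattice as LatticeProperties
import Algebra.Properties.CommutativeSemigroup as CommutativeSemigroupProperties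

module MVMonoidalProperties {ℓ : Level} (A : MVMonoidal ℓ) where
  open MVMonoidal A
  open IsCommutativeMonoid ⊕-isCommutativeMonoid using ()
    renaming (assoc to ⊕-assoc; comm to ⊕-comm; identityʳ to ⊕-identityʳ)
  open IsCommutativeMonoid ⊙-isCommutativeMonoid using ()
    renaming (assoc to ⊙-assoc; comm to ⊙-comm; identityʳ to ⊙-identityʳ)
  open IsDistributiveLattice isDistributiveLattice using (isLattice)
  open IsLattice isLattice using (∧-comm; ∧-assoc; ∨-comm; ∧-absorbs-∨)

  lattice : Lattice ℓ ℓ
  lattice = record { isLattice = isLattice }

  ⊕-commutativeMonoid : CommutativeMonoid ℓ ℓ
  ⊕-commutativeMonoid = record { isCommutativeMonoid = ⊕-isCommutativeMonoid }

  open LatticeProperties lattice using (∧-idem)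
  open CommutativeSemigroupProperties (CommutativeMonoid.commutativeSemigroup ⊕-commutativeMonoid)
    using () renaming (xy∙z≈xz∙y to ⊕-exchangeʳ)
  open ≡-Reasoning

  infix 4 _≼_
  _≼_ : Carrier → Carrier → Set ℓ
  x ≼ y = x ∧ y ≡ x

  ≼-antisym : ∀ {x y} → x ≼ y → y ≼ x → x ≡ y
  ≼-antisym {x} {y} x≼y y≼x = trans (sym x≼y) (trans (∧-comm x y) y≼x)

  x≼y∨x : ∀ x y → x ≼ y ∨ x
  x≼y∨x x y = trans (cong (x ∧_) (∨-comm y x)) (∧-absorbs-∨ x y)

  x∧y≼y : ∀ x y → x ∧ y ≼ y
  x∧y≼y x y = trans (∧-assoc x y y) (cong (x ∧_) (∧-idem y))

  z≼x⊙y⊕z : ∀ x y z → z ≼ x ⊙ y ⊕ z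
  z≼x⊙y⊕z x y z = subst (z ≼_) (sym (ax3 x y z)) (x≼y∨x z _)

  [x⊕y]⊙z≼z : ∀ x y z → (x ⊕ y) ⊙ z ≼ z
  [x⊕y]⊙z≼z x y z = subst (_≼ z) (sym (ax4 x y z)) (x∧y≼y _ z)

  𝟘≼x : ∀ x → 𝟘 ≼ x
  𝟘≼x x = subst (𝟘 ≼_) (trans (⊕-identityʳ (x ⊙ 𝟙)) (⊙-identityʳ x)) (z≼x⊙y⊕z x 𝟙 𝟘)

  x≼𝟙 : ∀ x → x ≼ 𝟙
  x≼𝟙 x = subst (_≼ 𝟙) (trans (⊙-identityʳ (x ⊕ 𝟘)) (⊕-identityʳ x)) ([x⊕y]⊙z≼z x 𝟘 𝟙)

  ⊕-monoʳ-≼ : ∀ x {y z} → y ≼ z → x ⊕ y ≼ x ⊕ z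
  ⊕-monoʳ-≼ x {y} {z} y≼z = trans (sym (⊕-distrib-∧ x y z)) (cong (x ⊕_) y≼z)

  ⊙-monoʳ-≼ : ∀ x {y z} → y ≼ z → x ⊙ y ≼ x ⊙ z
  ⊙-monoʳ-≼ x {y} {z} y≼z = trans (sym (⊙-distrib-∧ x y z)) (cong (x ⊙_) y≼z)

  x≼x⊕y : ∀ x y → x ≼ x ⊕ y
  x≼x⊕y x y = subst (_≼ x ⊕ y) (⊕-identityʳ x) (⊕-monoʳ-≼ x (𝟘≼x y))

  x⊙y≼x : ∀ x y → x ⊙ y ≼ x
  x⊙y≼x x y = subst (x ⊙ y ≼_) (⊙-identityʳ x) (⊙-monoʳ-≼ x (x≼𝟙 y))

  good-⊕-absorbs : ∀ {x y} → GoodPair A x y → ∀ z → x ⊕ y ⊙ z ≡ x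
  good-⊕-absorbs {x} {y} (x⊕y≡x , _) z = ≼-antisym upper (x≼x⊕y x (y ⊙ z))
    where
    upper : x ⊕ y ⊙ z ≼ x
    upper = subst (x ⊕ y ⊙ z ≼_) x⊕y≡x (⊕-monoʳ-≼ x (x⊙y≼x y z))

  good-⊙-absorbs : ∀ {x y} → GoodPair A x y → ∀ z → (x ⊕ z) ⊙ y ≡ y
  good-⊙-absorbs {x} {y} (_ , x⊙y≡y) z = ≼-antisym ([x⊕y]⊙z≼z x z y) lower
    where
    lower : y ≼ (x ⊕ z) ⊙ y
    lower = subst₂ _≼_ (trans (⊙-comm y x) x⊙y≡y) (⊙-comm y (x ⊕ z)) (⊙-monoʳ-≼ y (x≼x⊕y x z))

  good-interchange : ∀ {x y} → GoodPair A x y → ∀ z → x ⊙ (y ⊕ z) ≡ y ⊕ x ⊙ z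
  good-interchange {x} {y} (x⊕y≡x , x⊙y≡y) z = sym (begin
    y ⊕ x ⊙ z                ≡⟨ ⊕-comm y (x ⊙ z) ⟩
    x ⊙ z ⊕ y                ≡⟨ cong₂ _⊕_ (⊙-comm x z) (sym x⊙y≡y) ⟩
    z ⊙ x ⊕ x ⊙ y            ≡⟨ cong (λ t → z ⊙ t ⊕ x ⊙ y) (sym x⊕y≡x) ⟩
    z ⊙ (x ⊕ y) ⊕ x ⊙ y      ≡⟨ sym (ax1 z x y) ⟩
    (z ⊕ x) ⊙ (z ⊙ x ⊕ y)    ≡⟨ cong₂ (λ p q → p ⊙ (q ⊕ y)) (⊕-comm z x) (⊙-comm z x) ⟩
    (x ⊕ z) ⊙ (x ⊙ z ⊕ y)    ≡⟨ ax1 x z y ⟩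
    x ⊙ (z ⊕ y) ⊕ z ⊙ y      ≡⟨ cong₂ (λ p q → x ⊙ p ⊕ q) (⊕-comm z y) (⊙-comm z y) ⟩
    x ⊙ (y ⊕ z) ⊕ y ⊙ z      ≡⟨ sym (ax1 x y z) ⟩
    (x ⊕ y) ⊙ (x ⊙ y ⊕ z)    ≡⟨ cong₂ (λ p q → p ⊙ (q ⊕ z)) x⊕y≡x x⊙y≡y ⟩
    x ⊙ (y ⊕ z)              ∎)

  good-⊕ˡ : ∀ {x y} → GoodPair A x y → ∀ z → GoodPair A (x ⊕ z) y
  good-⊕ˡ {x} {y} g@(x⊕y≡x , _) z =
    trans (⊕-exchangeʳ x z y) (cong (_⊕ z) x⊕y≡x) , good-⊙-absorbs g z

  good-⊙ʳ : ∀ {x y} → GoodPair A x y → ∀ z → GoodPair A x (y ⊙ z)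
  good-⊙ʳ {x} {y} g@(_ , x⊙y≡y) z =
    good-⊕-absorbs g z , trans (sym (⊙-assoc x y z)) (cong (_⊙ z) x⊙y≡y)

  good-⊕ʳ : ∀ {x y z} → GoodPair A x y → GoodPair A x z → GoodPair A x (y ⊕ z)
  good-⊕ʳ {x} {y} {z} (x⊕y≡x , x⊙y≡y) g@(x⊕z≡x , _) =
    trans (sym (⊕-assoc x y z)) (trans (cong (_⊕ z) x⊕y≡x) x⊕z≡x) ,
    (begin
      x ⊙ (y ⊕ z)  ≡⟨ cong (x ⊙_) (⊕-comm y z) ⟩
      x ⊙ (z ⊕ y)  ≡⟨ good-interchange g y ⟩
      z ⊕ x ⊙ y    ≡⟨ cong (z ⊕_) x⊙y≡y ⟩
      z ⊕ y        ≡⟨ ⊕-comm z y ⟩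
      y ⊕ z        ∎)

  good-trans : ∀ {x y z} → GoodPair A x y → GoodPair A y z → GoodPair A x z
  good-trans {x} {y} {z} (x⊕y≡x , x⊙y≡y) (y⊕z≡y , y⊙z≡z) =
    trans (cong (_⊕ z) (sym x⊕y≡x)) (trans (⊕-assoc x y z) (trans (cong (x ⊕_) y⊕z≡y) x⊕y≡x)) ,
    trans (cong (x ⊙_) (sym y⊙z≡z)) (trans (sym (⊙-assoc x y z)) (trans (cong (_⊙ z) x⊙y≡y) y⊙z≡z))

module GoodConvolution
  {ℓ : Level} (A : MVMonoidal ℓ) (x y : ℕ → MVMonoidal.Carrier A) (n : ℕ)
  (x-good : ∀ i → i < n → GoodPair A (x i) (x (suc i)))
  (y-good : ∀ i → i < n → GoodPair A (y (suc i)) (y i))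
  where
  open MVMonoidal A
  open MVMonoidalProperties A
  open IsCommutativeMonoid ⊕-isCommutativeMonoid using ()
    renaming (assoc to ⊕-assoc; comm to ⊕-comm; identityˡ to ⊕-identityˡ; identityʳ to ⊕-identityʳ)
  open IsCommutativeMonoid ⊙-isCommutativeMonoid using ()
    renaming (assoc to ⊙-assoc; comm to ⊙-comm; identityˡ to ⊙-identityˡ; identityʳ to ⊙-identityʳ)
  open ≡-Reasoning

  leadingProduct : ℕ → Carrier
  leadingProduct k = x 0 ⊙ prodBelow A k (λ i → x (suc i) ⊕ y i)

  leadingProduct-suc : ∀ k → leadingProduct (suc k) ≡ leadingProduct k ⊙ (x (suc k) ⊕ y k)
  leadingProduct-suc k = sym (⊙-assoc (x 0) _ _)

  leadingProduct-good : ∀ k → k < n → GoodPair A (leadingProduct k) (x (suc k))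
  leadingProduct-good zero 0<n = subst (λ t → GoodPair A t (x 1)) (sym (⊙-identityʳ (x 0))) (x-good 0 0<n)
  leadingProduct-good (suc k) k+1<n =
    subst (λ t → GoodPair A t (x (suc (suc k)))) (sym unfold)
      (good-⊕ˡ (x-good (suc k) k+1<n) (leadingProduct k ⊙ y k))
    where
    unfold : leadingProduct (suc k) ≡ x (suc k) ⊕ leadingProduct k ⊙ y k
    unfold = trans (leadingProduct-suc k) (good-interchange (leadingProduct-good k (<⇒≤ k+1<n)) (y k))

  sum-of-products : ∀ k → k ≤ n → sumBelow A (suc k) (λ i → x i ⊙ y i) ≡ leadingProduct k ⊙ y k
  sum-of-products zero _ = trans (⊕-identityˡ (x 0 ⊙ y 0)) (cong (_⊙ y 0) (sym (⊙-identityʳ (x 0))))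
  sum-of-products (suc k) k<n = trans (cong (_⊕ u ⊙ w) (sum-of-products k (<⇒≤ k<n))) (sym (begin
    leadingProduct (suc k) ⊙ w  ≡⟨ cong (_⊙ w) (leadingProduct-suc k) ⟩
    L ⊙ (u ⊕ v) ⊙ w            ≡⟨ ⊙-assoc L (u ⊕ v) w ⟩
    L ⊙ ((u ⊕ v) ⊙ w)          ≡⟨ cong (L ⊙_) (trans (⊙-comm (u ⊕ v) w) (cong (w ⊙_) (⊕-comm u v))) ⟩
    L ⊙ (w ⊙ (v ⊕ u))          ≡⟨ cong (L ⊙_) (good-interchange (y-good k k<n) u) ⟩
    L ⊙ (v ⊕ w ⊙ u)            ≡⟨ cong (L ⊙_) (trans (⊕-comm v (w ⊙ u)) (cong (_⊕ v) (⊙-comm w u))) ⟩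
    L ⊙ (u ⊙ w ⊕ v)            ≡⟨ good-interchange (good-⊙ʳ (leadingProduct-good k k<n) w) v ⟩
    u ⊙ w ⊕ L ⊙ v              ≡⟨ ⊕-comm (u ⊙ w) (L ⊙ v) ⟩
    L ⊙ v ⊕ u ⊙ w              ∎))
    where
    L u v w : Carrier
    L = leadingProduct k
    u = x (suc k)
    v = y k
    w = y (suc k)

  trailingSum : ℕ → Carrier
  trailingSum k = y 0 ⊕ sumBelow A k (λ i → x i ⊙ y (suc i))

  trailingSum-suc : ∀ k → trailingSum (suc k) ≡ trailingSum k ⊕ x k ⊙ y (suc k)
  trailingSum-suc k = sym (⊕-assoc (y 0) _ _)

  trailingSum-good : ∀ k → k < n → GoodPair A (y (suc k)) (trailingSum k)
  trailingSum-good zero 0<n = subst (GoodPair A (y 1)) (sym (⊕-identityʳ (y 0))) (y-good 0 0<n)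
  trailingSum-good (suc k) k+1<n =
    subst (GoodPair A (y (suc (suc k))))
      (trans (cong (trailingSum k ⊕_) (⊙-comm (y (suc k)) (x k))) (sym (trailingSum-suc k)))
      (good-⊕ʳ (good-trans y-pair (trailingSum-good k (<⇒≤ k+1<n))) (good-⊙ʳ y-pair (x k)))
    where
    y-pair : GoodPair A (y (suc (suc k))) (y (suc k))
    y-pair = y-good (suc k) k+1<n

  product-of-sums : ∀ k → k ≤ n → prodBelow A (suc k) (λ i → x i ⊕ y i) ≡ trailingSum k ⊕ x k
  product-of-sums zero _ =
    trans (⊙-identityˡ _) (trans (⊕-comm (x 0) (y 0)) (cong (_⊕ x 0) (sym (⊕-identityʳ (y 0)))))
  product-of-sums (suc k) k<n = trans (cong (_⊙ (v ⊕ w)) (product-of-sums k (<⇒≤ k<n))) (begin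
    (T ⊕ u) ⊙ (v ⊕ w)      ≡⟨ trans (⊙-comm (T ⊕ u) (v ⊕ w)) (cong (_⊙ (T ⊕ u)) (⊕-comm v w)) ⟩
    (w ⊕ v) ⊙ (T ⊕ u)      ≡⟨ good-interchange (good-⊕ˡ (trailingSum-good k k<n) v) u ⟩
    T ⊕ (w ⊕ v) ⊙ u        ≡⟨ cong (T ⊕_) (trans (⊙-comm (w ⊕ v) u) (cong (u ⊙_) (⊕-comm w v))) ⟩
    T ⊕ u ⊙ (v ⊕ w)        ≡⟨ cong (T ⊕_) (good-interchange (x-good k k<n) w) ⟩
    T ⊕ (v ⊕ u ⊙ w)        ≡⟨ trans (cong (T ⊕_) (⊕-comm v (u ⊙ w))) (sym (⊕-assoc T (u ⊙ w) v)) ⟩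
    T ⊕ u ⊙ w ⊕ v          ≡⟨ cong (_⊕ v) (sym (trailingSum-suc k)) ⟩
    trailingSum (suc k) ⊕ v  ∎)
    where
    T u v w : Carrier
    T = trailingSum k
    u = x k
    v = x (suc k)
    w = y (suc k)

lemma7p8 : ∀ {ℓ : Level} (A : MVMonoidal ℓ) (m : ℕ) (a b : ℕ → MVMonoidal.Carrier A) →
    GoodSeqUpTo A m a → GoodSeqUpTo A m b →
    let open MVMonoidal A in
    (sumBelow A (suc m) (λ i → a i ⊙ b (m ∸ i))
    ≡ a 0 ⊙ prodBelow A m (λ i → a (suc i) ⊕ b (m ∸ i)) ⊙ b 0)
    × (prodBelow A (suc m) (λ i → a i ⊕ b (m ∸ i))
    ≡ b m ⊕ sumBelow A m (λ i → a i ⊙ b (m ∸ suc i)) ⊕ a m)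
lemma7p8 A m a b ga gb =
  trans (sum-of-products m ≤-refl) (cong (λ j → leadingProduct m ⊙ b j) (n∸n≡0 m)) ,
  product-of-sums m ≤-refl
  where
  open MVMonoidal A using (_⊙_)
  open GoodSeqUpTo

  b-reversed-good : ∀ i → i < m → GoodPair A (b (m ∸ suc i)) (b (m ∸ i))
  b-reversed-good i i<m = subst (GoodPair A (b (m ∸ suc i)) ∘ b) (sym (+-∸-assoc 1 i<m)) (good gb (m ∸ suc i))

  open GoodConvolution A a (λ i → b (m ∸ i)) m (λ i _ → good ga i) b-reversed-good
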